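{- Let $n\ge 1$ and let $A$ and $B$ be $n\times n$ alternating sign matrices satisfying $AB=I_n$. Then $A$ and $B$ are permutation matrices.
   Context: An alternating sign matrix (ASM) is a square matrix with entries in $\{0,1,-1\}$ such that in every row and every column the non-zero entries alternate in sign, beginning and ending with $+1$. -}

module Defs where

open import Data.Nat using (ℕ; zero; suc)
open import Data.Fin using (Fin) renaming (zero to fzero; suc to fsuc)
open import Data.Integer using (ℤ; +_; -[1+_]; _+_; _*_)
open import Data.List using (List; []; _∷_; filter; map)
open import Data.List using (allFin)
open import Data.Product using (_×_; ∃-syntax)
open import Data.Sum using (_⊎_)
open import Relation.Binary.PropositionalEquality using (_≡_; _≢_)
open import Relation.Nullary using (¬_)
open import Relation.Nullary.Decidable using (¬?)
import Data.Integer.Properties as ℤP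

Matrix : ℕ → Set
Matrix n = Fin n → Fin n → ℤ

row : ∀ {n} → Matrix n → Fin n → List ℤ
row {n} M i = map (λ j → M i j) (allFin n)

col : ∀ {n} → Matrix n → Fin n → List ℤ
col {n} M j = map (λ i → M i j) (allFin n)

nonzeros : List ℤ → List ℤ
nonzeros = filter (λ x → ¬? (x ℤP.≟ + 0))

data Alt : List ℤ → Set where
  alt-one  : Alt (+ 1 ∷ [])
  alt-cons : ∀ {xs} → Alt xs → Alt (+ 1 ∷ -[1+ 0 ] ∷ xs)

AlternatingLine : List ℤ → Set
AlternatingLine xs = Alt (nonzeros xs)

IsASM : ∀ {n} → Matrix n → Set
IsASM {n} M =
  (∀ i j → (M i j ≡ + 0) ⊎ (M i j ≡ + 1) ⊎ (M i j ≡ -[1+ 0 ])) ×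
  (∀ i → AlternatingLine (row M i)) ×
  (∀ j → AlternatingLine (col M j))

∑ : ∀ n → (Fin n → ℤ) → ℤ
∑ zero    f = + 0
∑ (suc n) f = f fzero + ∑ n (λ k → f (fsuc k))

_⊗_ : ∀ {n} → Matrix n → Matrix n → Matrix n
_⊗_ {n} A B i j = ∑ n (λ k → A i k * B k j)

I : ∀ n → Matrix n
I n i j with i Data.Fin.≟ j
... | Relation.Nullary.yes _ = + 1
... | Relation.Nullary.no _  = + 0

IsPermutationMatrix : ∀ {n} → Matrix n → Set
IsPermutationMatrix {n} M =
  (∀ i j → (M i j ≡ + 0) ⊎ (M i j ≡ + 1)) ×
  (∀ i → ∃[ j ] (M i j ≡ + 1 × (∀ j' → M i j' ≡ + 1 → j' ≡ j))) ×
  (∀ j → ∃[ i ] (M i j ≡ + 1 × (∀ i' → M i' j ≡ + 1 → i' ≡ i)))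

-- Write a_t(k) for the sum of the first t entries of column k of A, and
-- b_k(u) for the sum of the first u entries of row k of B.  Because A and B
-- are alternating sign matrices these partial sums are all 0 or 1, and since
-- AB = I we have  ∑_k a_t(k) b_k(u) = min(t, u),  while  ∑_k a_t(k) = t  and
-- ∑_k b_k(u) = u  because every line of an ASM sums to 1.  Taking u = t + 1,
-- the first identity says that every k with a_t(k) = 1 has b_k(t+1) = 1, and
-- then every such k has a_{t+1}(k) = 1.  So the partial column sums of A never
-- drop from 1 to 0, i.e. A has no entry -1; by symmetry (transpose) neither
-- has B, and a 0/1 matrix whose lines all sum to 1 is a permutation matrix.
module Submission where

open import Defs
open import Data.Nat using (ℕ; _≥_; zero; suc) renaming (_≤_ to _≤ℕ_; s≤s to s≤sℕ; z≤n to z≤nℕ)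
import Data.Nat.Properties as ℕP
open import Data.Fin using (Fin; toℕ) renaming (zero to fzero; suc to fsuc)
import Data.Fin as Fin
open import Data.Integer using (ℤ; +_; +[1+_]; -[1+_]; _+_; _*_; _≤_; +≤+)
import Data.Integer.Properties as ℤP
open import Algebra.Properties.AbelianGroup ℤP.+-0-abelianGroup using (∙-cancelˡ)
open import Algebra.Properties.CommutativeSemigroup ℤP.+-commutativeSemigroup using (interchange)
open import Data.List using (List; []; _∷_; map; allFin)
import Data.List.Properties as List
open import Data.Product using (_×_; _,_; proj₁; proj₂; ∃-syntax)
open import Data.Sum using (_⊎_; inj₁; inj₂)
open import Data.Empty using (⊥-elim)
open import Function using (_∘_; const)
open import Relation.Binary.PropositionalEquality
open import Relation.Nullary using (yes; no)

ZeroOrOne : ℤ → Set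
ZeroOrOne x = x ≡ + 0 ⊎ x ≡ + 1

ZeroOrOne⇒0≤ : ∀ {x} → ZeroOrOne x → + 0 ≤ x
ZeroOrOne⇒0≤ (inj₁ refl) = ℤP.≤-refl
ZeroOrOne⇒0≤ (inj₂ refl) = +≤+ z≤nℕ

ZeroOrOne-*-≤ : ∀ {x y} → ZeroOrOne x → ZeroOrOne y → x * y ≤ x
ZeroOrOne-*-≤ (inj₁ refl) _           = ℤP.≤-refl
ZeroOrOne-*-≤ (inj₂ refl) (inj₁ refl) = +≤+ z≤nℕ
ZeroOrOne-*-≤ (inj₂ refl) (inj₂ refl) = ℤP.≤-refl

ZeroOrOne-increment : ∀ {p q x} → q ≡ p + x → ZeroOrOne p → ZeroOrOne q →
                      (p ≡ + 1 → q ≡ + 1) → ZeroOrOne x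
ZeroOrOne-increment {x = x} q≡p+x (inj₁ refl) q01 _ = subst ZeroOrOne (trans q≡p+x (ℤP.+-identityˡ x)) q01
ZeroOrOne-increment q≡p+x (inj₂ refl) _ p≡1⇒q≡1 =
  inj₁ (sym (∙-cancelˡ (+ 1) _ _ (trans (sym (p≡1⇒q≡1 refl)) q≡p+x)))

+-≡-≤⇒≡ : ∀ {a b c d} → a ≤ b → c ≤ d → a + c ≡ b + d → a ≡ b × c ≡ d
+-≡-≤⇒≡ {a} {b} {c} {d} a≤b c≤d a+c≡b+d = a≡b , ∙-cancelˡ a c d (trans a+c≡b+d (cong (_+ d) (sym a≡b)))
  where
  a≡b : a ≡ b
  a≡b = ℤP.≤-antisym a≤b (ℤP.≮⇒≥ (λ a<b → ℤP.<-irrefl a+c≡b+d (ℤP.+-mono-<-≤ a<b c≤d)))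

∑-cong : ∀ n {f g : Fin n → ℤ} → (∀ k → f k ≡ g k) → ∑ n f ≡ ∑ n g
∑-cong zero    f≗g = refl
∑-cong (suc n) f≗g = cong₂ _+_ (f≗g fzero) (∑-cong n (f≗g ∘ fsuc))

∑-zero : ∀ n → ∑ n (const (+ 0)) ≡ + 0
∑-zero zero    = refl
∑-zero (suc n) = trans (ℤP.+-identityˡ _) (∑-zero n)

∑-distrib-+ : ∀ n (f g : Fin n → ℤ) → ∑ n (λ k → f k + g k) ≡ ∑ n f + ∑ n g
∑-distrib-+ zero    f g = refl
∑-distrib-+ (suc n) f g =
  trans (cong (_+_ (f fzero + g fzero)) (∑-distrib-+ n (f ∘ fsuc) (g ∘ fsuc)))
        (interchange (f fzero) (g fzero) _ _)

∑-mono-≤ : ∀ n {f g : Fin n → ℤ} → (∀ k → f k ≤ g k) → ∑ n f ≤ ∑ n g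
∑-mono-≤ zero    f≤g = ℤP.≤-refl
∑-mono-≤ (suc n) f≤g = ℤP.+-mono-≤ (f≤g fzero) (∑-mono-≤ n (f≤g ∘ fsuc))

∑-≡-≤⇒≡ : ∀ n {f g : Fin n → ℤ} → (∀ k → f k ≤ g k) → ∑ n f ≡ ∑ n g → ∀ k → f k ≡ g k
∑-≡-≤⇒≡ (suc n) f≤g ∑f≡∑g fzero =
  proj₁ (+-≡-≤⇒≡ (f≤g fzero) (∑-mono-≤ n (f≤g ∘ fsuc)) ∑f≡∑g)
∑-≡-≤⇒≡ (suc n) f≤g ∑f≡∑g (fsuc k) =
  ∑-≡-≤⇒≡ n (f≤g ∘ fsuc) (proj₂ (+-≡-≤⇒≡ (f≤g fzero) (∑-mono-≤ n (f≤g ∘ fsuc)) ∑f≡∑g)) k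

∑≡0⇒≡0 : ∀ n (f : Fin n → ℤ) → (∀ k → ZeroOrOne (f k)) → ∑ n f ≡ + 0 → ∀ k → f k ≡ + 0
∑≡0⇒≡0 n f f01 ∑f≡0 k =
  sym (∑-≡-≤⇒≡ n (ZeroOrOne⇒0≤ ∘ f01) (trans (∑-zero n) (sym ∑f≡0)) k)

∑≡1⇒unique-one : ∀ n (f : Fin n → ℤ) → (∀ k → ZeroOrOne (f k)) → ∑ n f ≡ + 1 →
                 ∃[ j ] (f j ≡ + 1 × (∀ j' → f j' ≡ + 1 → j' ≡ j))
∑≡1⇒unique-one (suc n) f f01 ∑f≡1 with f01 fzero
... | inj₂ f₀≡1 = fzero , f₀≡1 , only-fzero
  where
  rest≡0 : ∑ n (f ∘ fsuc) ≡ + 0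
  rest≡0 = ∙-cancelˡ (+ 1) _ _ (trans (cong (_+ ∑ n (f ∘ fsuc)) (sym f₀≡1)) ∑f≡1)
  only-fzero : ∀ j → f j ≡ + 1 → j ≡ fzero
  only-fzero fzero    _     = refl
  only-fzero (fsuc j) fj≡1 with () ← trans (sym fj≡1) (∑≡0⇒≡0 n (f ∘ fsuc) (f01 ∘ fsuc) rest≡0 j)
... | inj₁ f₀≡0
  with ∑≡1⇒unique-one n (f ∘ fsuc) (f01 ∘ fsuc)
         (trans (sym (ℤP.+-identityˡ _)) (trans (cong (_+ ∑ n (f ∘ fsuc)) (sym f₀≡0)) ∑f≡1))
...   | j , fj≡1 , unique = fsuc j , fj≡1 , only-fsuc-j
  where
  only-fsuc-j : ∀ j' → f j' ≡ + 1 → j' ≡ fsuc j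
  only-fsuc-j fzero     f₀≡1  with () ← trans (sym f₀≡0) f₀≡1
  only-fsuc-j (fsuc j') fj'≡1 = cong fsuc (unique j' fj'≡1)

∑-*-≡-∑⇒ones-⊆ : ∀ n (x z : Fin n → ℤ) → (∀ k → ZeroOrOne (x k)) → (∀ k → ZeroOrOne (z k)) →
                 ∑ n (λ k → x k * z k) ≡ ∑ n x → ∀ k → x k ≡ + 1 → z k ≡ + 1
∑-*-≡-∑⇒ones-⊆ n x z x01 z01 ∑xz≡∑x k xk≡1 = begin
  z k          ≡⟨ sym (ℤP.*-identityˡ (z k)) ⟩
  + 1 * z k    ≡⟨ cong (_* z k) (sym xk≡1) ⟩
  x k * z k    ≡⟨ ∑-≡-≤⇒≡ n (λ k → ZeroOrOne-*-≤ (x01 k) (z01 k)) ∑xz≡∑x k ⟩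
  x k          ≡⟨ xk≡1 ⟩
  + 1          ∎
  where open ≡-Reasoning

-- the sum of the first t terms (of all terms when t ≥ n)
prefixSum : ℕ → ∀ n → (Fin n → ℤ) → ℤ
prefixSum zero    n       f = + 0
prefixSum (suc t) zero    f = + 0
prefixSum (suc t) (suc n) f = f fzero + prefixSum t n (f ∘ fsuc)

prefixSum-cong : ∀ t n {f g : Fin n → ℤ} → (∀ k → f k ≡ g k) → prefixSum t n f ≡ prefixSum t n g
prefixSum-cong zero    n       f≗g = refl
prefixSum-cong (suc t) zero    f≗g = refl
prefixSum-cong (suc t) (suc n) f≗g = cong₂ _+_ (f≗g fzero) (prefixSum-cong t n (f≗g ∘ fsuc))

prefixSum-zero : ∀ t n → prefixSum t n (const (+ 0)) ≡ + 0
prefixSum-zero zero    n       = refl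
prefixSum-zero (suc t) zero    = refl
prefixSum-zero (suc t) (suc n) = trans (ℤP.+-identityˡ _) (prefixSum-zero t n)

prefixSum-suc : ∀ n (f : Fin n → ℤ) (m : Fin n) →
                prefixSum (suc (toℕ m)) n f ≡ prefixSum (toℕ m) n f + f m
prefixSum-suc (suc n) f fzero    = trans (ℤP.+-identityʳ (f fzero)) (sym (ℤP.+-identityˡ (f fzero)))
prefixSum-suc (suc n) f (fsuc m) =
  trans (cong (_+_ (f fzero)) (prefixSum-suc n (f ∘ fsuc) m))
        (sym (ℤP.+-assoc (f fzero) _ (f (fsuc m))))

∑-prefixSum-comm : ∀ t n K (g : Fin n → Fin K → ℤ) →
                   ∑ K (λ k → prefixSum t n (λ m → g m k)) ≡ prefixSum t n (λ m → ∑ K (g m))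
∑-prefixSum-comm zero    n       K g = ∑-zero K
∑-prefixSum-comm (suc t) zero    K g = ∑-zero K
∑-prefixSum-comm (suc t) (suc n) K g =
  trans (∑-distrib-+ K (g fzero) (λ k → prefixSum t n (λ m → g (fsuc m) k)))
        (cong (_+_ (∑ K (g fzero))) (∑-prefixSum-comm t n K (g ∘ fsuc)))

*-distribˡ-prefixSum : ∀ t n c (f : Fin n → ℤ) → c * prefixSum t n f ≡ prefixSum t n (λ m → c * f m)
*-distribˡ-prefixSum zero    n       c f = ℤP.*-zeroʳ c
*-distribˡ-prefixSum (suc t) zero    c f = ℤP.*-zeroʳ c
*-distribˡ-prefixSum (suc t) (suc n) c f =
  trans (ℤP.*-distribˡ-+ c (f fzero) _) (cong (_+_ (c * f fzero)) (*-distribˡ-prefixSum t n c (f ∘ fsuc)))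

*-distribʳ-prefixSum : ∀ t n c (f : Fin n → ℤ) → prefixSum t n f * c ≡ prefixSum t n (λ m → f m * c)
*-distribʳ-prefixSum zero    n       c f = ℤP.*-zeroˡ c
*-distribʳ-prefixSum (suc t) zero    c f = ℤP.*-zeroˡ c
*-distribʳ-prefixSum (suc t) (suc n) c f =
  trans (ℤP.*-distribʳ-+ c (f fzero) _) (cong (_+_ (f fzero * c)) (*-distribʳ-prefixSum t n c (f ∘ fsuc)))

δ : ∀ {n} → Fin n → Fin n → ℤ
δ fzero    fzero    = + 1
δ fzero    (fsuc _) = + 0
δ (fsuc _) fzero    = + 0
δ (fsuc i) (fsuc j) = δ i j

δ-refl : ∀ {n} (i : Fin n) → δ i i ≡ + 1
δ-refl fzero    = refl
δ-refl (fsuc i) = δ-refl i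

δ-≢ : ∀ {n} (i j : Fin n) → i ≢ j → δ i j ≡ + 0
δ-≢ fzero    fzero    i≢j = ⊥-elim (i≢j refl)
δ-≢ fzero    (fsuc j) _   = refl
δ-≢ (fsuc i) fzero    _   = refl
δ-≢ (fsuc i) (fsuc j) i≢j = δ-≢ i j (i≢j ∘ cong fsuc)

δ-sym : ∀ {n} (i j : Fin n) → δ i j ≡ δ j i
δ-sym fzero    fzero    = refl
δ-sym fzero    (fsuc j) = refl
δ-sym (fsuc i) fzero    = refl
δ-sym (fsuc i) (fsuc j) = δ-sym i j

I≡δ : ∀ n (i j : Fin n) → I n i j ≡ δ i j
I≡δ n i j with i Fin.≟ j
... | yes refl = sym (δ-refl i)
... | no  i≢j  = sym (δ-≢ i j i≢j)

prefixSum-prefixSum-δ : ∀ t u n → t ≤ℕ u →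
                        prefixSum t n (λ m → prefixSum u n (δ m)) ≡ prefixSum t n (const (+ 1))
prefixSum-prefixSum-δ zero    u       n       _           = refl
prefixSum-prefixSum-δ (suc t) (suc u) zero    _           = refl
prefixSum-prefixSum-δ (suc t) (suc u) (suc n) (s≤sℕ t≤u) =
  cong₂ _+_ (cong (_+_ (+ 1)) (prefixSum-zero u n))
            (trans (prefixSum-cong t n (λ _ → ℤP.+-identityˡ _)) (prefixSum-prefixSum-δ t u n t≤u))

-- AltSuffix s ys: ys is what is left of the nonzero entries of an
-- alternating line after reading a prefix whose sum is s.
data AltSuffix : ℤ → List ℤ → Set where
  sum0     : ∀ {ys} → Alt ys → AltSuffix (+ 0) ys
  sum1-end : AltSuffix (+ 1) []
  sum1     : ∀ {ys} → Alt ys → AltSuffix (+ 1) (-[1+ 0 ] ∷ ys)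

AltSuffix-ZeroOrOne : ∀ {s ys} → AltSuffix s ys → ZeroOrOne s
AltSuffix-ZeroOrOne (sum0 _) = inj₁ refl
AltSuffix-ZeroOrOne sum1-end = inj₂ refl
AltSuffix-ZeroOrOne (sum1 _) = inj₂ refl

AltSuffix-read : ∀ {s x zs} → AltSuffix s (x ∷ zs) → AltSuffix (s + x) zs
AltSuffix-read (sum0 alt-one)      = sum1-end
AltSuffix-read (sum0 (alt-cons a)) = sum1 a
AltSuffix-read (sum1 a)            = sum0 a

AltSuffix-step : ∀ {s} x ys → AltSuffix s (nonzeros (x ∷ ys)) → AltSuffix (s + x) (nonzeros ys)
AltSuffix-step {s} (+ 0)      ys h = subst (λ v → AltSuffix v (nonzeros ys)) (sym (ℤP.+-identityʳ s)) h
AltSuffix-step     +[1+ _ ]   ys h = AltSuffix-read h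
AltSuffix-step     -[1+ _ ]   ys h = AltSuffix-read h

map-allFin-suc : ∀ n (f : Fin (suc n) → ℤ) → map f (allFin (suc n)) ≡ f fzero ∷ map (f ∘ fsuc) (allFin n)
map-allFin-suc n f =
  trans (List.map-tabulate (λ x → x) f) (cong (f fzero ∷_) (sym (List.map-tabulate (λ x → x) (f ∘ fsuc))))

AltSuffix-tail : ∀ n (f : Fin (suc n) → ℤ) {s} → AltSuffix s (nonzeros (map f (allFin (suc n)))) →
                 AltSuffix (s + f fzero) (nonzeros (map (f ∘ fsuc) (allFin n)))
AltSuffix-tail n f {s} h =
  AltSuffix-step (f fzero) _ (subst (λ l → AltSuffix s (nonzeros l)) (map-allFin-suc n f) h)

AltSuffix⇒∑ : ∀ n (f : Fin n → ℤ) {s} → AltSuffix s (nonzeros (map f (allFin n))) → s + ∑ n f ≡ + 1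
AltSuffix⇒∑ zero    f sum1-end = refl
AltSuffix⇒∑ (suc n) f {s} h    = trans (sym (ℤP.+-assoc s _ _)) (AltSuffix⇒∑ n (f ∘ fsuc) (AltSuffix-tail n f h))

AltSuffix⇒prefixSum : ∀ n (f : Fin n → ℤ) {s} → AltSuffix s (nonzeros (map f (allFin n))) →
                      ∀ t → ZeroOrOne (s + prefixSum t n f)
AltSuffix⇒prefixSum n       f {s} h zero    = subst ZeroOrOne (sym (ℤP.+-identityʳ s)) (AltSuffix-ZeroOrOne h)
AltSuffix⇒prefixSum zero    f {s} h (suc t) = subst ZeroOrOne (sym (ℤP.+-identityʳ s)) (AltSuffix-ZeroOrOne h)
AltSuffix⇒prefixSum (suc n) f {s} h (suc t) =
  subst ZeroOrOne (ℤP.+-assoc s _ _) (AltSuffix⇒prefixSum n (f ∘ fsuc) (AltSuffix-tail n f h) t)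

alternating⇒∑≡1 : ∀ n (f : Fin n → ℤ) → AlternatingLine (map f (allFin n)) → ∑ n f ≡ + 1
alternating⇒∑≡1 n f alt = trans (sym (ℤP.+-identityˡ _)) (AltSuffix⇒∑ n f (sum0 alt))

alternating⇒prefixSum-ZeroOrOne : ∀ n (f : Fin n → ℤ) → AlternatingLine (map f (allFin n)) →
                                  ∀ t → ZeroOrOne (prefixSum t n f)
alternating⇒prefixSum-ZeroOrOne n f alt t =
  subst ZeroOrOne (ℤP.+-identityˡ _) (AltSuffix⇒prefixSum n f (sum0 alt) t)

module _ {n} (A B : Matrix n)
         (colsA : ∀ k → AlternatingLine (col A k)) (rowSumsA : ∀ m → ∑ n (A m) ≡ + 1)
         (rowsB : ∀ k → AlternatingLine (row B k)) (colSumsB : ∀ l → ∑ n (λ k → B k l) ≡ + 1)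
         (AB≡δ : ∀ m l → (A ⊗ B) m l ≡ δ m l)
  where

  private
    colPrefix : ℕ → Fin n → ℤ
    colPrefix t k = prefixSum t n (λ m → A m k)

    rowPrefix : Fin n → ℕ → ℤ
    rowPrefix k u = prefixSum u n (B k)

    colPrefix-01 : ∀ t k → ZeroOrOne (colPrefix t k)
    colPrefix-01 t k = alternating⇒prefixSum-ZeroOrOne n (λ m → A m k) (colsA k) t

    rowPrefix-01 : ∀ u k → ZeroOrOne (rowPrefix k u)
    rowPrefix-01 u k = alternating⇒prefixSum-ZeroOrOne n (B k) (rowsB k) u

    ∑-colPrefix : ∀ t → ∑ n (colPrefix t) ≡ prefixSum t n (const (+ 1))
    ∑-colPrefix t = trans (∑-prefixSum-comm t n n A) (prefixSum-cong t n rowSumsA)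

    ∑-rowPrefix : ∀ u → ∑ n (λ k → rowPrefix k u) ≡ prefixSum u n (const (+ 1))
    ∑-rowPrefix u = trans (∑-prefixSum-comm u n n (λ l k → B k l)) (prefixSum-cong u n colSumsB)

    ∑-colPrefix-*-rowPrefix : ∀ t u → ∑ n (λ k → colPrefix t k * rowPrefix k u) ≡
                                      prefixSum t n (λ m → prefixSum u n (δ m))
    ∑-colPrefix-*-rowPrefix t u = begin
      ∑ n (λ k → colPrefix t k * rowPrefix k u)
        ≡⟨ ∑-cong n (λ k → *-distribʳ-prefixSum t n (rowPrefix k u) (λ m → A m k)) ⟩
      ∑ n (λ k → prefixSum t n (λ m → A m k * rowPrefix k u))
        ≡⟨ ∑-prefixSum-comm t n n (λ m k → A m k * rowPrefix k u) ⟩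
      prefixSum t n (λ m → ∑ n (λ k → A m k * rowPrefix k u))
        ≡⟨ prefixSum-cong t n (λ m → ∑-cong n (λ k → *-distribˡ-prefixSum u n (A m k) (B k))) ⟩
      prefixSum t n (λ m → ∑ n (λ k → prefixSum u n (λ l → A m k * B k l)))
        ≡⟨ prefixSum-cong t n (λ m → ∑-prefixSum-comm u n n (λ l k → A m k * B k l)) ⟩
      prefixSum t n (λ m → prefixSum u n ((A ⊗ B) m))
        ≡⟨ prefixSum-cong t n (λ m → prefixSum-cong u n (AB≡δ m)) ⟩
      prefixSum t n (λ m → prefixSum u n (δ m))
        ∎
      where open ≡-Reasoning

    colPrefix-persists : ∀ t k → colPrefix t k ≡ + 1 → colPrefix (suc t) k ≡ + 1
    colPrefix-persists t k = rowOnes⊆colOnes k ∘ colOnes⊆rowOnes k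
      where
      colOnes⊆rowOnes : ∀ k → colPrefix t k ≡ + 1 → rowPrefix k (suc t) ≡ + 1
      colOnes⊆rowOnes = ∑-*-≡-∑⇒ones-⊆ n (colPrefix t) (λ k → rowPrefix k (suc t)) (colPrefix-01 t) (rowPrefix-01 (suc t))
              (trans (∑-colPrefix-*-rowPrefix t (suc t))
                     (trans (prefixSum-prefixSum-δ t (suc t) n (ℕP.n≤1+n t)) (sym (∑-colPrefix t))))
      rowOnes⊆colOnes : ∀ k → rowPrefix k (suc t) ≡ + 1 → colPrefix (suc t) k ≡ + 1
      rowOnes⊆colOnes = ∑-*-≡-∑⇒ones-⊆ n (λ k → rowPrefix k (suc t)) (colPrefix (suc t)) (rowPrefix-01 (suc t)) (colPrefix-01 (suc t))
               (trans (∑-cong n (λ k → ℤP.*-comm (rowPrefix k (suc t)) (colPrefix (suc t) k)))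
               (trans (∑-colPrefix-*-rowPrefix (suc t) (suc t))
               (trans (prefixSum-prefixSum-δ (suc t) (suc t) n ℕP.≤-refl) (sym (∑-rowPrefix (suc t))))))

  ASM-inverse-entries-ZeroOrOne : ∀ m k → ZeroOrOne (A m k)
  ASM-inverse-entries-ZeroOrOne m k =
    ZeroOrOne-increment (prefixSum-suc n (λ i → A i k) m) (colPrefix-01 (toℕ m) k)
      (colPrefix-01 (suc (toℕ m)) k) (colPrefix-persists (toℕ m) k)

_ᵀ : ∀ {n} → Matrix n → Matrix n
(M ᵀ) i j = M j i

⊗-ᵀ : ∀ {n} (A B : Matrix n) i j → ((B ᵀ) ⊗ (A ᵀ)) i j ≡ (A ⊗ B) j i
⊗-ᵀ {n} A B i j = ∑-cong n (λ k → ℤP.*-comm (B k i) (A j k))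

ZeroOrOne-line-sums⇒permutation : ∀ {n} (M : Matrix n) → (∀ i j → ZeroOrOne (M i j)) →
  (∀ i → ∑ n (M i) ≡ + 1) → (∀ j → ∑ n (λ i → M i j) ≡ + 1) → IsPermutationMatrix M
ZeroOrOne-line-sums⇒permutation {n} M M01 rowSums colSums =
  M01 , (λ i → ∑≡1⇒unique-one n (M i) (M01 i) (rowSums i))
      , (λ j → ∑≡1⇒unique-one n (λ i → M i j) (λ i → M01 i j) (colSums j))

lemma1p2 : (n : ℕ) → n ≥ 1 → (A B : Matrix n) → IsASM A → IsASM B →
    (∀ i j → (A ⊗ B) i j ≡ I n i j) →
    IsPermutationMatrix A × IsPermutationMatrix B
lemma1p2 n _ A B (_ , rowsA , colsA) (_ , rowsB , colsB) AB≡I =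
  ZeroOrOne-line-sums⇒permutation A A01 rowSumsA colSumsA ,
  ZeroOrOne-line-sums⇒permutation B (λ i j → Bᵀ01 j i) rowSumsB colSumsB
  where
  rowSumsA : ∀ i → ∑ n (A i) ≡ + 1
  rowSumsA = λ i → alternating⇒∑≡1 n (A i) (rowsA i)
  colSumsA : ∀ j → ∑ n (λ i → A i j) ≡ + 1
  colSumsA = λ j → alternating⇒∑≡1 n (λ i → A i j) (colsA j)
  rowSumsB : ∀ i → ∑ n (B i) ≡ + 1
  rowSumsB = λ i → alternating⇒∑≡1 n (B i) (rowsB i)
  colSumsB : ∀ j → ∑ n (λ i → B i j) ≡ + 1
  colSumsB = λ j → alternating⇒∑≡1 n (λ i → B i j) (colsB j)
  AB≡δ : ∀ i j → (A ⊗ B) i j ≡ δ i j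
  AB≡δ i j = trans (AB≡I i j) (I≡δ n i j)
  A01 : ∀ i j → ZeroOrOne (A i j)
  A01 = ASM-inverse-entries-ZeroOrOne A B colsA rowSumsA rowsB colSumsB AB≡δ
  Bᵀ01 : ∀ i j → ZeroOrOne (B j i)
  Bᵀ01 = ASM-inverse-entries-ZeroOrOne (B ᵀ) (A ᵀ) rowsB colSumsB colsA rowSumsA
           (λ i j → trans (⊗-ᵀ A B i j) (trans (AB≡δ j i) (δ-sym j i)))
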